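{- Let $S,P$ be disjoint finite sets, $\mathcal{V}_{SP}$ a vector space on $S\uplus P$, and $\mathcal{K}_P=\mathcal{V}_P+L_P$ a generalized number lattice on $P$ with $\mathcal{V}_P$ a vector space, $L_P$ a number lattice and $\mathcal{V}_P\cap L_P=\{0_P\}$. Let $\mathcal{K}_S:=\mathcal{V}_{SP}\leftrightarrow\mathcal{K}_P$ and $\mathcal{V}_S:=\mathcal{V}_{SP}\leftrightarrow\mathcal{V}_P$. Suppose $\mathcal{V}_{SP}\times P\subseteq\mathcal{V}_P$ and $\mathcal{V}_{SP}\circ P\supseteq\mathcal{K}_P$. Then: 1. $\mathcal{V}_{SP}\leftrightarrow\mathcal{K}_S=\mathcal{K}_P$ and $\mathcal{V}_{SP}\leftrightarrow\mathcal{V}_S=\mathcal{V}_P$. 2. Let $B_P$ be a basis matrix for $L_P$ with rows $x_{1P},\dots,x_{nP}$. Then there exist vectors $\hat x_{iS}$, $i=1,\dots,n$, with $(\hat x_{iS},x_{iP})\in\mathcal{V}_{SP}$; and for any such choice, the matrix $B_S$ whose $i$-th row is $\hat x_{iS}$ has linearly independent rows and is a basis matrix for a number lattice $L_S\subseteq\mathcal{V}_{SP}\leftrightarrow L_P$ such that $L_P\subseteq\mathcal{V}_{SP}\leftrightarrow L_S$, $\mathcal{V}_S\cap L_S=\{0_S\}$ and $\mathcal{K}_S=\mathcal{V}_S+L_S$. 3. Let $L'_S$ be a number lattice with $L'_S\subseteq\mathcal{V}_{SP}\leftrightarrow L_P$, $L'_S\cap\mathcal{V}_S=\{0_S\}$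 and $L_P\subseteq\mathcal{V}_{SP}\leftrightarrow L'_S$. Then (a) for every $x_P\in L_P$ with $x_P\neq 0_P$ there is a unique $\hat x_S\in L'_S$ with $(\hat x_S,x_P)\in\mathcal{V}_{SP}$, and $\hat x_S\ne 0_S$; (b) if $B_P$ is a basis matrix for $L_P$ with rows $x_{1P},\dots,x_{nP}$ and $\hat x_{iS}\in L'_S$ satisfy $(\hat x_{iS},x_{iP})\in\mathcal{V}_{SP}$, then the matrix $B_S$ with $i$-th row $\hat x_{iS}$ is a basis matrix for $L'_S$; (c) $\mathcal{K}_S=L'_S+\mathcal{V}_S$.
   Context: All vectors are over $\mathbb{Q}$; a vector on a finite set $X$ is a function $X\to\mathbb{Q}$, $0_X$ the zero vector, and $(f_X,g_Y)$ the vector on $X\uplus Y$ formed from $f_X,g_Y$. A number lattice is the set of integer linear combinations of finitely many vectors; a basis matrix of a number lattice is a matrix with linearly independent rows generating it by integer combinations. A generalized number lattice is a sum $L+\mathcal{V}$ of a number lattice and a vector space. Restriction: $\mathcal{K}_{SP}\circ P=\{f_P:\exists f_S,(f_S,f_P)\in\mathcal{K}_{SP}\}$; contraction: $\mathcal{K}_{SP}\times P=\{f_P:(0_S,f_P)\in\mathcal{K}_{SP}\}$. Matched composition: for $\mathcal{K}_{SP}$ on $S\uplus P$ and $\mathcal{K}_P$ on $P$, $\mathcal{K}_{SP}\leftrightarrow\mathcal{K}_P=\{f_S:\exists h_P\in\mathcal{K}_P,\ (f_S,h_P)\in\mathcal{K}_{SP}\}$, and symmetrically $\mathcal{K}_{SP}\leftrightarrow\mathcal{K}_S=\{f_P:\exists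 h_S\in\mathcal{K}_S,(h_S,f_P)\in\mathcal{K}_{SP}\}$. -}

module Defs where

open import Data.Nat using (ℕ; zero; suc; _+_)
open import Data.Integer using (ℤ; +_)
open import Data.Rational using (ℚ; 0ℚ; _/_) renaming (_+_ to _+ℚ_; _*_ to _*ℚ_)
open import Data.Fin using (Fin; zero; suc)
open import Data.Vec using (Vec; replicate; zipWith; map; _++_)
open import Data.Product using (Σ; _×_; _,_; ∃)
open import Relation.Binary.PropositionalEquality using (_≡_)

-- A vector on a finite set X of size n is an element of ℚ^n (Data.Vec ℚ n);
-- the disjoint union S ⊎ P corresponds to concatenation, (f_S , f_P) = f_S ++ f_P.
Vect : ℕ → Set
Vect n = Vec ℚ n

VSet : ℕ → Set₁
VSet n = Vect n → Set

zeroV : (n : ℕ) → Vect n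
zeroV n = replicate n 0ℚ

_+V_ : {n : ℕ} → Vect n → Vect n → Vect n
_+V_ = zipWith _+ℚ_

_·V_ : {n : ℕ} → ℚ → Vect n → Vect n
c ·V x = map (c *ℚ_) x

ℤtoℚ : ℤ → ℚ
ℤtoℚ z = z / 1

vsum : {n : ℕ} (m : ℕ) → (Fin m → Vect n) → Vect n
vsum {n} zero f = zeroV n
vsum (suc m) f = f zero +V vsum m (λ i → f (suc i))

lincomb : {n m : ℕ} → (Fin m → ℚ) → (Fin m → Vect n) → Vect n
lincomb {m = m} c x = vsum m (λ i → c i ·V x i)

_⊆_ : {n : ℕ} → VSet n → VSet n → Set
A ⊆ B = ∀ x → A x → B x

_≐_ : {n : ℕ} → VSet n → VSet n → Set
A ≐ B = (A ⊆ B) × (B ⊆ A)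

_⊕_ : {n : ℕ} → VSet n → VSet n → VSet n
(A ⊕ B) x = Σ _ λ a → Σ _ λ b → A a × B b × (x ≡ a +V b)

-- A ∩ B = {0}  (both sets here contain 0, so it suffices that the intersection is ⊆ {0})
TrivialMeet : {n : ℕ} → VSet n → VSet n → Set
TrivialMeet {n} A B = ∀ x → A x → B x → x ≡ zeroV n

record IsVectorSpace {n : ℕ} (V : VSet n) : Set where
  field
    zero-mem : V (zeroV n)
    add-mem  : ∀ x y → V x → V y → V (x +V y)
    smul-mem : ∀ (c : ℚ) x → V x → V (c ·V x)

ZSpan : {n m : ℕ} → (Fin m → Vect n) → VSet n
ZSpan {m = m} g x = Σ (Fin m → ℤ) λ c → x ≡ lincomb (λ i → ℤtoℚ (c i)) g

IsNumberLattice : {n : ℕ} → VSet n → Set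
IsNumberLattice {n} L = Σ ℕ λ m → Σ (Fin m → Vect n) λ g → L ≐ ZSpan g

LinIndep : {n m : ℕ} → (Fin m → Vect n) → Set
LinIndep {m = m} x = ∀ (c : Fin m → ℚ) → lincomb c x ≡ zeroV _ → ∀ i → c i ≡ 0ℚ

IsBasisMatrix : {n m : ℕ} → (Fin m → Vect n) → VSet n → Set
IsBasisMatrix B L = LinIndep B × (L ≐ ZSpan B)

restrictP : {s p : ℕ} → VSet (s + p) → VSet p
restrictP {s} K fP = Σ (Vect s) λ fS → K (fS ++ fP)

contractP : {s p : ℕ} → VSet (s + p) → VSet p
contractP {s} K fP = K (zeroV s ++ fP)

_↔P_ : {s p : ℕ} → VSet (s + p) → VSet p → VSet s
(K ↔P KP) fS = Σ _ λ hP → KP hP × K (fS ++ hP)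

_↔S_ : {s p : ℕ} → VSet (s + p) → VSet s → VSet p
(K ↔S KS) fP = Σ _ λ hS → KS hS × K (hS ++ fP)

module Submission where

-- Everything rests on reading VSP ⊆ ℚ^(S ⊎ P) as a linear relation between
-- S-vectors and P-vectors.  Two P-partners of one S-vector differ by an element
-- of the contraction VSP × P ⊆ VP; this gives part (1) (recover) and, together
-- with the subtraction closure of a lattice, the uniqueness of partners in (3a).
-- Integer combinations of related pairs are related, so lifts x̂ᵢ of a basis
-- B of LP carry ZSpan B onto ZSpan x̂ and back (Lifts.span-⊆, Lifts.⊆-span).
-- The number-theoretic input is coefficients-vanish: a rational combination of
-- B lying in VP becomes, after clearing denominators, a lattice vector of VP,
-- hence zero, so all its coefficients vanish.  It yields independence of the
-- lifts, the trivial meet of their span with VSP ↔ VP, and (3b).  Finally any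
-- S-lattice L in correspondence with LP splits VSP ↔ (VP + LP) as
-- (VSP ↔ VP) + L (split), which is the last claim of (2) and (3c).

open import Defs
open import Data.Nat as ℕ using (ℕ; zero; suc; _+_)
open import Data.Integer as ℤ using (ℤ; +_)
open import Data.Rational as ℚ using (ℚ; 0ℚ; 1ℚ; -_; 1/_; ↥_; mkℚ; toℚᵘ; ≢-nonZero)
  renaming (_+_ to _+ℚ_; _*_ to _*ℚ_)
open import Data.Rational.Properties as ℚP using (toℚᵘ-injective; toℚᵘ-fromℚᵘ)
import Data.Rational.Unnormalised as ℚᵘ
import Data.Rational.Unnormalised.Properties as ℚᵘP
import Data.Integer.Solver as ℤSolver
import Data.Rational.Solver as ℚSolver
open import Data.Fin using (Fin; zero; suc)
open import Data.Vec using ([]; _∷_; replicate; map; _++_)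
open import Data.Vec.Properties
  using (zipWith-comm; zipWith-assoc; zipWith-identityˡ; zipWith-identityʳ; zipWith-inverseʳ;
         zipWith-++; map-++; map-cong; map-id; map-∘; map-replicate; map-const)
open import Data.Product using (Σ; _×_; _,_; proj₁; proj₂)
open import Relation.Nullary using (¬_)
open import Relation.Binary.PropositionalEquality

module IntegersInRationals where

  private
    asFraction : ∀ a → toℚᵘ (ℤtoℚ a) ℚᵘ.≃ ℚᵘ.mkℚᵘ a 0
    asFraction a = toℚᵘ-fromℚᵘ (ℚᵘ.mkℚᵘ a 0)

    viaFractions : ∀ {x y} (u : ℚᵘ.ℚᵘ) → toℚᵘ x ℚᵘ.≃ u → toℚᵘ y ℚᵘ.≃ u → x ≡ y
    viaFractions u x≃u y≃u = toℚᵘ-injective (ℚᵘP.≃-trans x≃u (ℚᵘP.≃-sym y≃u))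

  ℤtoℚ-+ : ∀ a b → ℤtoℚ (a ℤ.+ b) ≡ ℤtoℚ a +ℚ ℤtoℚ b
  ℤtoℚ-+ a b = viaFractions (ℚᵘ.mkℚᵘ a 0 ℚᵘ.+ ℚᵘ.mkℚᵘ b 0)
    (ℚᵘP.≃-trans (asFraction (a ℤ.+ b))
      (ℚᵘ.*≡* (solve 2 (λ x y → (x :+ y) :* (con (+ 1) :* con (+ 1))
                              := (x :* con (+ 1) :+ y :* con (+ 1)) :* con (+ 1)) refl a b)))
    (ℚᵘP.≃-trans (ℚP.toℚᵘ-homo-+ (ℤtoℚ a) (ℤtoℚ b)) (ℚᵘP.+-cong (asFraction a) (asFraction b)))
    where open ℤSolver.+-*-Solver

  ℤtoℚ-* : ∀ a b → ℤtoℚ (a ℤ.* b) ≡ ℤtoℚ a *ℚ ℤtoℚ b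
  ℤtoℚ-* a b = viaFractions (ℚᵘ.mkℚᵘ a 0 ℚᵘ.* ℚᵘ.mkℚᵘ b 0)
    (ℚᵘP.≃-trans (asFraction (a ℤ.* b))
      (ℚᵘ.*≡* (solve 2 (λ x y → (x :* y) :* (con (+ 1) :* con (+ 1))
                              := (x :* y) :* con (+ 1)) refl a b)))
    (ℚᵘP.≃-trans (ℚP.toℚᵘ-homo-* (ℤtoℚ a) (ℤtoℚ b)) (ℚᵘP.*-cong (asFraction a) (asFraction b)))
    where open ℤSolver.+-*-Solver

  denominator-clears : ∀ q → Σ ℕ λ d → ℤtoℚ (↥ q) ≡ ℤtoℚ (+ suc d) *ℚ q
  denominator-clears q@(mkℚ n d _) = d , viaFractions (ℚᵘ.mkℚᵘ n 0)
    (asFraction n)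
    (ℚᵘP.≃-trans (ℚP.toℚᵘ-homo-* (ℤtoℚ (+ suc d)) q)
      (ℚᵘP.≃-trans (ℚᵘP.*-cong (asFraction (+ suc d)) ℚᵘP.≃-refl)
        (ℚᵘ.*≡* (solve 2 (λ x y → (x :* y) :* con (+ 1) := y :* (con (+ 1) :* x)) refl (+ suc d) n))))
    where open ℤSolver.+-*-Solver

  positive≢0 : ∀ n → ¬ (ℤtoℚ (+ suc n) ≡ 0ℚ)
  positive≢0 n eq with ℚᵘP.≃-trans (ℚᵘP.≃-sym (asFraction (+ suc n))) (ℚᵘP.≃-reflexive (cong toℚᵘ eq))
  ... | ℚᵘ.*≡* ()

  commonDenominator : ∀ {m} (c : Fin m → ℚ) →
    Σ ℕ λ D → Σ (Fin m → ℤ) λ k → ∀ i → ℤtoℚ (k i) ≡ ℤtoℚ (+ suc D) *ℚ c i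
  commonDenominator {zero} c = 0 , (λ ()) , (λ ())
  commonDenominator {suc m} c with commonDenominator (λ i → c (suc i)) | denominator-clears (c zero)
  ... | D , k , k≡Dc | d , ↥c≡Ec = D + d ℕ.* suc D , k′ , k′≡D′c
    where
    open ℚSolver.+-*-Solver
    E F : ℚ
    E = ℤtoℚ (+ suc d)
    F = ℤtoℚ (+ suc D)
    D′≡EF : ℤtoℚ (+ suc (D + d ℕ.* suc D)) ≡ E *ℚ F
    D′≡EF = ℤtoℚ-* (+ suc d) (+ suc D)
    k′ : Fin (suc m) → ℤ
    k′ zero = ↥ c zero ℤ.* + suc D
    k′ (suc i) = + suc d ℤ.* k i
    k′≡D′c : ∀ i → ℤtoℚ (k′ i) ≡ ℤtoℚ (+ suc (D + d ℕ.* suc D)) *ℚ c i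
    k′≡D′c zero = begin
      ℤtoℚ (↥ c zero ℤ.* + suc D)  ≡⟨ ℤtoℚ-* (↥ c zero) (+ suc D) ⟩
      ℤtoℚ (↥ c zero) *ℚ F         ≡⟨ cong (_*ℚ F) ↥c≡Ec ⟩
      (E *ℚ c zero) *ℚ F           ≡⟨ solve 3 (λ e f x → (e :* x) :* f := (e :* f) :* x) refl E F (c zero) ⟩
      (E *ℚ F) *ℚ c zero           ≡⟨ cong (_*ℚ c zero) (sym D′≡EF) ⟩
      _ ∎
      where open ≡-Reasoning
    k′≡D′c (suc i) = begin
      ℤtoℚ (+ suc d ℤ.* k i)       ≡⟨ ℤtoℚ-* (+ suc d) (k i) ⟩
      E *ℚ ℤtoℚ (k i)              ≡⟨ cong (E *ℚ_) (k≡Dc i) ⟩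
      E *ℚ (F *ℚ c (suc i))        ≡⟨ solve 3 (λ e f x → e :* (f :* x) := (e :* f) :* x) refl E F (c (suc i)) ⟩
      (E *ℚ F) *ℚ c (suc i)        ≡⟨ cong (_*ℚ c (suc i)) (sym D′≡EF) ⟩
      _ ∎
      where open ≡-Reasoning

module VectorAlgebra where
  open ℚP using (+-comm; +-assoc; +-identityˡ; +-identityʳ; +-inverseʳ;
                 *-distribˡ-+; *-distribʳ-+; *-assoc; *-identityˡ; *-zeroˡ; *-zeroʳ)

  negV : ∀ {n} → Vect n → Vect n
  negV = map -_

  infixl 6 _-V_
  _-V_ : ∀ {n} → Vect n → Vect n → Vect n
  x -V y = x +V negV y

  +V-comm : ∀ {n} (x y : Vect n) → x +V y ≡ y +V x
  +V-comm = zipWith-comm +-comm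

  +V-assoc : ∀ {n} (x y z : Vect n) → (x +V y) +V z ≡ x +V (y +V z)
  +V-assoc = zipWith-assoc +-assoc

  +V-identityˡ : ∀ {n} (x : Vect n) → zeroV n +V x ≡ x
  +V-identityˡ = zipWith-identityˡ +-identityˡ

  +V-identityʳ : ∀ {n} (x : Vect n) → x +V zeroV n ≡ x
  +V-identityʳ = zipWith-identityʳ +-identityʳ

  -V-self : ∀ {n} (x : Vect n) → x -V x ≡ zeroV n
  -V-self = zipWith-inverseʳ +-inverseʳ

  -V-+V : ∀ {n} (x y : Vect n) → (x -V y) +V y ≡ x
  -V-+V {n} x y = begin
    (x -V y) +V y          ≡⟨ +V-assoc x (negV y) y ⟩
    x +V (negV y +V y)     ≡⟨ cong (x +V_) (+V-comm (negV y) y) ⟩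
    x +V (y -V y)          ≡⟨ cong (x +V_) (-V-self y) ⟩
    x +V zeroV n           ≡⟨ +V-identityʳ x ⟩
    x                      ∎
    where open ≡-Reasoning

  +V--V : ∀ {n} (x y : Vect n) → (x +V y) -V y ≡ x
  +V--V {n} x y = begin
    (x +V y) -V y          ≡⟨ +V-assoc x y (negV y) ⟩
    x +V (y -V y)          ≡⟨ cong (x +V_) (-V-self y) ⟩
    x +V zeroV n           ≡⟨ +V-identityʳ x ⟩
    x                      ∎
    where open ≡-Reasoning

  -V≡0⇒≡ : ∀ {n} (x y : Vect n) → x -V y ≡ zeroV n → x ≡ y
  -V≡0⇒≡ {n} x y x-y≡0 = begin
    x                      ≡⟨ sym (-V-+V x y) ⟩
    (x -V y) +V y          ≡⟨ cong (_+V y) x-y≡0 ⟩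
    zeroV n +V y           ≡⟨ +V-identityˡ y ⟩
    y                      ∎
    where open ≡-Reasoning

  ·V-distrib-+V : ∀ {n} c (x y : Vect n) → c ·V (x +V y) ≡ (c ·V x) +V (c ·V y)
  ·V-distrib-+V c [] [] = refl
  ·V-distrib-+V c (a ∷ x) (b ∷ y) = cong₂ _∷_ (*-distribˡ-+ c a b) (·V-distrib-+V c x y)

  +-distrib-·V : ∀ {n} c d (x : Vect n) → (c +ℚ d) ·V x ≡ (c ·V x) +V (d ·V x)
  +-distrib-·V c d [] = refl
  +-distrib-·V c d (a ∷ x) = cong₂ _∷_ (*-distribʳ-+ a c d) (+-distrib-·V c d x)

  ·V-assoc : ∀ {n} c d (x : Vect n) → c ·V (d ·V x) ≡ (c *ℚ d) ·V x
  ·V-assoc c d x = trans (sym (map-∘ (c *ℚ_) (d *ℚ_) x)) (map-cong (λ a → sym (*-assoc c d a)) x)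

  ·V-identity : ∀ {n} (x : Vect n) → 1ℚ ·V x ≡ x
  ·V-identity x = trans (map-cong *-identityˡ x) (map-id x)

  ·V-zeroˡ : ∀ {n} (x : Vect n) → 0ℚ ·V x ≡ zeroV n
  ·V-zeroˡ x = trans (map-cong *-zeroˡ x) (map-const x 0ℚ)

  ·V-zeroʳ : ∀ {n} c → c ·V zeroV n ≡ zeroV n
  ·V-zeroʳ {n} c = trans (map-replicate (c *ℚ_) 0ℚ n) (cong (replicate n) (*-zeroʳ c))

  -1·V : ∀ {n} (x : Vect n) → (- 1ℚ) ·V x ≡ negV x
  -1·V x = map-cong (λ a → trans (sym (ℚP.neg-distribˡ-* 1ℚ a)) (cong -_ (*-identityˡ a))) x

  ·V-cancel : ∀ {n} c .{{_ : ℚ.NonZero c}} (x : Vect n) → c ·V x ≡ zeroV n → x ≡ zeroV n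
  ·V-cancel {n} c x cx≡0 = begin
    x                      ≡⟨ sym (·V-identity x) ⟩
    1ℚ ·V x                ≡⟨ cong (_·V x) (sym (ℚP.*-inverseˡ c)) ⟩
    ((1/ c) *ℚ c) ·V x     ≡⟨ sym (·V-assoc (1/ c) c x) ⟩
    (1/ c) ·V (c ·V x)     ≡⟨ cong ((1/ c) ·V_) cx≡0 ⟩
    (1/ c) ·V zeroV n      ≡⟨ ·V-zeroʳ (1/ c) ⟩
    zeroV n                ∎
    where open ≡-Reasoning

  ++-+V : ∀ {s p} (a c : Vect s) (b d : Vect p) → (a ++ b) +V (c ++ d) ≡ (a +V c) ++ (b +V d)
  ++-+V a c b d = zipWith-++ _+ℚ_ a b c d

  ++-·V : ∀ {s p} k (a : Vect s) (b : Vect p) → k ·V (a ++ b) ≡ (k ·V a) ++ (k ·V b)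
  ++-·V k a b = map-++ (k *ℚ_) a b

  ++-zero : ∀ s p → zeroV (s + p) ≡ zeroV s ++ zeroV p
  ++-zero zero p = refl
  ++-zero (suc s) p = cong (0ℚ ∷_) (++-zero s p)

  vsum-cong : ∀ {n} m (f g : Fin m → Vect n) → (∀ i → f i ≡ g i) → vsum m f ≡ vsum m g
  vsum-cong zero f g f≗g = refl
  vsum-cong (suc m) f g f≗g = cong₂ _+V_ (f≗g zero) (vsum-cong m _ _ (λ i → f≗g (suc i)))

  vsum-zero : ∀ {n} m → vsum m (λ _ → zeroV n) ≡ zeroV n
  vsum-zero zero = refl
  vsum-zero {n} (suc m) = trans (cong (zeroV n +V_) (vsum-zero m)) (+V-identityˡ _)

  +V-interchange : ∀ {n} (a b c d : Vect n) → (a +V b) +V (c +V d) ≡ (a +V c) +V (b +V d)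
  +V-interchange a b c d = begin
    (a +V b) +V (c +V d)   ≡⟨ +V-assoc a b (c +V d) ⟩
    a +V (b +V (c +V d))   ≡⟨ cong (a +V_) (sym (+V-assoc b c d)) ⟩
    a +V ((b +V c) +V d)   ≡⟨ cong (λ z → a +V (z +V d)) (+V-comm b c) ⟩
    a +V ((c +V b) +V d)   ≡⟨ cong (a +V_) (+V-assoc c b d) ⟩
    a +V (c +V (b +V d))   ≡⟨ sym (+V-assoc a c (b +V d)) ⟩
    (a +V c) +V (b +V d)   ∎
    where open ≡-Reasoning

  vsum-+V : ∀ {n} m (f g : Fin m → Vect n) → vsum m (λ i → f i +V g i) ≡ vsum m f +V vsum m g
  vsum-+V {n} zero f g = sym (+V-identityˡ (zeroV n))
  vsum-+V (suc m) f g = trans (cong ((f zero +V g zero) +V_) (vsum-+V m _ _)) (+V-interchange _ _ _ _)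

  vsum-·V : ∀ {n} m k (f : Fin m → Vect n) → vsum m (λ i → k ·V f i) ≡ k ·V vsum m f
  vsum-·V {n} zero k f = sym (·V-zeroʳ k)
  vsum-·V (suc m) k f = trans (cong ((k ·V f zero) +V_) (vsum-·V m k _)) (sym (·V-distrib-+V k _ _))

  vsum-++ : ∀ {s p} m (f : Fin m → Vect s) (g : Fin m → Vect p) →
    vsum m (λ i → f i ++ g i) ≡ vsum m f ++ vsum m g
  vsum-++ {s} {p} zero f g = ++-zero s p
  vsum-++ (suc m) f g = trans (cong ((f zero ++ g zero) +V_) (vsum-++ m (λ i → f (suc i)) (λ i → g (suc i))))
                              (++-+V (f zero) _ (g zero) _)

  lincomb-cong : ∀ {n m} (c d : Fin m → ℚ) (x : Fin m → Vect n) → (∀ i → c i ≡ d i) → lincomb c x ≡ lincomb d x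
  lincomb-cong {m = m} c d x c≗d = vsum-cong m _ _ (λ i → cong (_·V x i) (c≗d i))

  lincomb-+ : ∀ {n m} (c d : Fin m → ℚ) (x : Fin m → Vect n) →
    lincomb (λ i → c i +ℚ d i) x ≡ lincomb c x +V lincomb d x
  lincomb-+ {m = m} c d x = trans (vsum-cong m _ _ (λ i → +-distrib-·V (c i) (d i) (x i))) (vsum-+V m _ _)

  lincomb-· : ∀ {n m} k (c : Fin m → ℚ) (x : Fin m → Vect n) → lincomb (λ i → k *ℚ c i) x ≡ k ·V lincomb c x
  lincomb-· {m = m} k c x = trans (vsum-cong m _ _ (λ i → sym (·V-assoc k (c i) (x i)))) (vsum-·V m k _)

  lincomb-zero : ∀ {n m} (x : Fin m → Vect n) → lincomb (λ _ → 0ℚ) x ≡ zeroV n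
  lincomb-zero {m = m} x = trans (vsum-cong m _ _ (λ i → ·V-zeroˡ (x i))) (vsum-zero m)

  lincomb-++ : ∀ {s p m} (c : Fin m → ℚ) (a : Fin m → Vect s) (b : Fin m → Vect p) →
    lincomb c (λ i → a i ++ b i) ≡ lincomb c a ++ lincomb c b
  lincomb-++ {m = m} c a b = trans (vsum-cong m _ _ (λ i → ++-·V (c i) (a i) (b i))) (vsum-++ m _ _)

open IntegersInRationals
open VectorAlgebra

module Subspace {n} {V : VSet n} (isVS : IsVectorSpace V) where
  open IsVectorSpace isVS

  neg-mem : ∀ x → V x → V (negV x)
  neg-mem x x∈V = subst V (-1·V x) (smul-mem (- 1ℚ) x x∈V)

  sub-mem : ∀ x y → V x → V y → V (x -V y)
  sub-mem x y x∈V y∈V = add-mem x (negV y) x∈V (neg-mem y y∈V)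

  vsum-mem : ∀ m (f : Fin m → Vect n) → (∀ i → V (f i)) → V (vsum m f)
  vsum-mem zero f f∈V = zero-mem
  vsum-mem (suc m) f f∈V = add-mem _ _ (f∈V zero) (vsum-mem m (λ i → f (suc i)) (λ i → f∈V (suc i)))

  lincomb-mem : ∀ {m} (c : Fin m → ℚ) x → (∀ i → V (x i)) → V (lincomb c x)
  lincomb-mem {m} c x x∈V = vsum-mem m _ (λ i → smul-mem (c i) (x i) (x∈V i))

intCoeffs : ∀ {m} → (Fin m → ℤ) → Fin m → ℚ
intCoeffs k i = ℤtoℚ (k i)

unitCoeffs : ∀ {m} → Fin m → Fin m → ℤ
unitCoeffs zero zero = + 1
unitCoeffs zero (suc j) = + 0
unitCoeffs (suc i) zero = + 0
unitCoeffs (suc i) (suc j) = unitCoeffs i j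

lincomb-unit : ∀ {n m} (i : Fin m) (x : Fin m → Vect n) → lincomb (intCoeffs (unitCoeffs i)) x ≡ x i
lincomb-unit zero x = trans (cong₂ _+V_ (·V-identity (x zero)) (lincomb-zero (λ j → x (suc j)))) (+V-identityʳ _)
lincomb-unit (suc i) x = trans (cong₂ _+V_ (·V-zeroˡ (x zero)) (lincomb-unit i (λ j → x (suc j)))) (+V-identityˡ _)

module IntegerSpan {n m : ℕ} (g : Fin m → Vect n) where

  zero-mem : ZSpan g (zeroV n)
  zero-mem = (λ _ → + 0) , sym (lincomb-zero g)

  add-mem : ∀ x y → ZSpan g x → ZSpan g y → ZSpan g (x +V y)
  add-mem x y (k , x≡) (l , y≡) = (λ i → k i ℤ.+ l i) , (begin
    x +V y                                                       ≡⟨ cong₂ _+V_ x≡ y≡ ⟩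
    lincomb (intCoeffs k) g +V lincomb (intCoeffs l) g           ≡⟨ lincomb-+ (intCoeffs k) (intCoeffs l) g ⟨
    lincomb (λ i → intCoeffs k i +ℚ intCoeffs l i) g             ≡⟨ lincomb-cong _ _ g (λ i → ℤtoℚ-+ (k i) (l i)) ⟨
    lincomb (λ i → ℤtoℚ (k i ℤ.+ l i)) g                         ∎)
    where open ≡-Reasoning

  int-smul-mem : ∀ a x → ZSpan g x → ZSpan g (ℤtoℚ a ·V x)
  int-smul-mem a x (k , x≡) = (λ i → a ℤ.* k i) , (begin
    ℤtoℚ a ·V x                                   ≡⟨ cong (ℤtoℚ a ·V_) x≡ ⟩
    ℤtoℚ a ·V lincomb (intCoeffs k) g             ≡⟨ lincomb-· (ℤtoℚ a) (intCoeffs k) g ⟨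
    lincomb (λ i → ℤtoℚ a *ℚ intCoeffs k i) g     ≡⟨ lincomb-cong _ _ g (λ i → ℤtoℚ-* a (k i)) ⟨
    lincomb (λ i → ℤtoℚ (a ℤ.* k i)) g            ∎)
    where open ≡-Reasoning

  sub-mem : ∀ x y → ZSpan g x → ZSpan g y → ZSpan g (x -V y)
  sub-mem x y x∈ y∈ = add-mem x (negV y) x∈ (subst (ZSpan g) (-1·V y) (int-smul-mem (ℤ.- + 1) y y∈))

  gen-mem : ∀ i → ZSpan g (g i)
  gen-mem i = unitCoeffs i , sym (lincomb-unit i g)

  lincomb-mem : ∀ {k} (y : Fin k → Vect n) → (∀ i → ZSpan g (y i)) → (a : Fin k → ℤ) →
    ZSpan g (lincomb (intCoeffs a) y)
  lincomb-mem {zero} y y∈ a = zero-mem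
  lincomb-mem {suc k} y y∈ a =
    add-mem _ _ (int-smul-mem (a zero) (y zero) (y∈ zero))
                (lincomb-mem (λ i → y (suc i)) (λ i → y∈ (suc i)) (λ i → a (suc i)))

module NumberLattice {n} {L : VSet n} (isNL : IsNumberLattice L) where
  private
    g : Fin (proj₁ isNL) → Vect n
    g = proj₁ (proj₂ isNL)
    L⊆span : L ⊆ ZSpan g
    L⊆span = proj₁ (proj₂ (proj₂ isNL))
    span⊆L : ZSpan g ⊆ L
    span⊆L = proj₂ (proj₂ (proj₂ isNL))
    module Span = IntegerSpan g

  zero-mem : L (zeroV n)
  zero-mem = span⊆L _ Span.zero-mem

  sub-mem : ∀ x y → L x → L y → L (x -V y)
  sub-mem x y x∈L y∈L = span⊆L _ (Span.sub-mem x y (L⊆span x x∈L) (L⊆span y y∈L))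

  lincomb-mem : ∀ {k} (y : Fin k → Vect n) → (∀ i → L (y i)) → (a : Fin k → ℤ) → L (lincomb (intCoeffs a) y)
  lincomb-mem y y∈L a = span⊆L _ (Span.lincomb-mem y (λ i → L⊆span (y i) (y∈L i)) a)

-- If a subspace V meets the lattice L trivially, a rational combination of a
-- basis of L lies in V only when all its coefficients vanish: clearing
-- denominators turns it into a lattice vector of V, hence zero.
coefficients-vanish : ∀ {n m} {V L : VSet n} (B : Fin m → Vect n) →
  IsVectorSpace V → TrivialMeet V L → IsBasisMatrix B L →
  ∀ c → V (lincomb c B) → ∀ i → c i ≡ 0ℚ
coefficients-vanish {n} {L = L} B isVS meet (indep , _ , span⊆L) c w∈V
  with commonDenominator c
... | D , k , k≡Dc = indep c w≡0
  where
  w : Vect n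
  w = lincomb c B
  Dq : ℚ
  Dq = ℤtoℚ (+ suc D)
  integral : lincomb (intCoeffs k) B ≡ Dq ·V w
  integral = trans (lincomb-cong _ _ B k≡Dc) (lincomb-· Dq c B)
  Dw≡0 : Dq ·V w ≡ zeroV n
  Dw≡0 = meet _ (IsVectorSpace.smul-mem isVS Dq w w∈V) (subst L integral (span⊆L _ (k , refl)))
  w≡0 : w ≡ zeroV n
  w≡0 = ·V-cancel Dq {{≢-nonZero (positive≢0 D)}} w Dw≡0

⊕-comm : ∀ {n} (A B : VSet n) → (A ⊕ B) ⊆ (B ⊕ A)
⊕-comm A B x (a , b , a∈A , b∈B , x≡a+b) = b , a , b∈B , a∈A , trans x≡a+b (+V-comm a b)

⊕-inclusionˡ : ∀ {n} (A B : VSet n) → B (zeroV n) → A ⊆ (A ⊕ B)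
⊕-inclusionˡ {n} A B 0∈B x x∈A = x , zeroV n , x∈A , 0∈B , sym (+V-identityʳ x)

⊕-inclusionʳ : ∀ {n} (A B : VSet n) → A (zeroV n) → B ⊆ (A ⊕ B)
⊕-inclusionʳ {n} A B 0∈A x x∈B = zeroV n , x , 0∈A , x∈B , sym (+V-identityˡ x)

⊕-translate : ∀ {n} (A B : VSet n) → (∀ x y → A x → A y → A (x +V y)) →
  ∀ w k → A w → (A ⊕ B) k → (A ⊕ B) (w +V k)
⊕-translate A B add-mem w k w∈A (a , b , a∈A , b∈B , k≡a+b) =
  w +V a , b , add-mem w a w∈A a∈A , b∈B , trans (cong (w +V_) k≡a+b) (sym (+V-assoc w a b))

basis-mem : ∀ {n m} {L : VSet n} (B : Fin m → Vect n) → IsBasisMatrix B L → ∀ i → L (B i)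
basis-mem B (_ , _ , span⊆L) i = span⊆L (B i) (IntegerSpan.gen-mem B i)

module MatchedComposition {s p : ℕ} (VSP : VSet (s + p)) (isVS : IsVectorSpace VSP) where
  private module VSP = Subspace isVS

  pair-add : ∀ (a : Vect s) (b : Vect p) (c : Vect s) (d : Vect p) →
    VSP (a ++ b) → VSP (c ++ d) → VSP ((a +V c) ++ (b +V d))
  pair-add a b c d ab∈ cd∈ = subst VSP (++-+V a c b d) (IsVectorSpace.add-mem isVS (a ++ b) (c ++ d) ab∈ cd∈)

  pair-sub : ∀ (a : Vect s) (b : Vect p) (c : Vect s) (d : Vect p) →
    VSP (a ++ b) → VSP (c ++ d) → VSP ((a -V c) ++ (b -V d))
  pair-sub a b c d ab∈ cd∈ = subst VSP eq (VSP.sub-mem (a ++ b) (c ++ d) ab∈ cd∈)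
    where
    eq : (a ++ b) -V (c ++ d) ≡ (a -V c) ++ (b -V d)
    eq = trans (cong ((a ++ b) +V_) (map-++ -_ c d)) (++-+V a (negV c) b (negV d))

  pair-lincomb : ∀ {m} (c : Fin m → ℚ) (a : Fin m → Vect s) (b : Fin m → Vect p) →
    (∀ i → VSP (a i ++ b i)) → VSP (lincomb c a ++ lincomb c b)
  pair-lincomb c a b ab∈ = subst VSP (lincomb-++ c a b) (VSP.lincomb-mem c _ ab∈)

  partner-difference : {W : VSet p} → contractP {s} VSP ⊆ W →
    ∀ (a : Vect s) (b b′ : Vect p) → VSP (a ++ b) → VSP (a ++ b′) → W (b -V b′)
  partner-difference contr a b b′ ab∈ ab′∈ =
    contr (b -V b′) (subst (λ z → VSP (z ++ (b -V b′))) (-V-self a) (pair-sub a b a b′ ab∈ ab′∈))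

  recover : (W K : VSet p) → contractP {s} VSP ⊆ W → (∀ w k → W w → K k → K (w +V k)) →
    K ⊆ restrictP {s} VSP → (VSP ↔S (VSP ↔P K)) ≐ K
  recover W K contr translate K⊆restr = back , forth
    where
    back : (VSP ↔S (VSP ↔P K)) ⊆ K
    back x (hS , (hP , hP∈K , hShP∈) , hSx∈) =
      subst K (-V-+V x hP) (translate (x -V hP) hP (partner-difference contr hS x hP hSx∈ hShP∈) hP∈K)
    forth : K ⊆ (VSP ↔S (VSP ↔P K))
    forth x x∈K with K⊆restr x x∈K
    ... | xS , xSx∈ = xS , (x , x∈K , xSx∈) , xSx∈

  split : (VP LP : VSet p) (L : VSet s) → L ⊆ (VSP ↔P LP) → LP ⊆ (VSP ↔S L) →
    (VSP ↔P (VP ⊕ LP)) ≐ ((VSP ↔P VP) ⊕ L)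
  split VP LP L L⊆ LP⊆ = into , onto
    where
    into : (VSP ↔P (VP ⊕ LP)) ⊆ ((VSP ↔P VP) ⊕ L)
    into x (hP , (a , b , a∈VP , b∈LP , hP≡a+b) , xhP∈) with LP⊆ b b∈LP
    ... | y , y∈L , yb∈ = x -V y , y , (a , a∈VP , difference∈) , y∈L , sym (-V-+V x y)
      where
      difference∈ : VSP ((x -V y) ++ a)
      difference∈ = subst (λ z → VSP ((x -V y) ++ z)) (trans (cong (_-V b) hP≡a+b) (+V--V a b))
                          (pair-sub x hP y b xhP∈ yb∈)
    onto : ((VSP ↔P VP) ⊕ L) ⊆ (VSP ↔P (VP ⊕ LP))
    onto x (a , b , (hP , hP∈VP , ahP∈) , b∈L , x≡a+b) with L⊆ b b∈L
    ... | w , w∈LP , bw∈ = hP +V w , (hP , w , hP∈VP , w∈LP , refl) ,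
      subst (λ z → VSP (z ++ (hP +V w))) (sym x≡a+b) (pair-add a hP b w ahP∈ bw∈)

  partner-unique : {VP : VSet p} {L : VSet s} → VP (zeroV p) → IsNumberLattice L →
    TrivialMeet L (VSP ↔P VP) → ∀ y z (x : Vect p) → L y → L z → VSP (y ++ x) → VSP (z ++ x) → y ≡ z
  partner-unique 0∈VP isNL meet y z x y∈L z∈L yx∈ zx∈ =
    -V≡0⇒≡ y z (meet (y -V z) (NumberLattice.sub-mem isNL y z y∈L z∈L) (zeroV p , 0∈VP , difference∈))
    where
    difference∈ : VSP ((y -V z) ++ zeroV p)
    difference∈ = subst (λ w → VSP ((y -V z) ++ w)) (-V-self x) (pair-sub y x z x yx∈ zx∈)

  partner-nonzero : {VP LP : VSet p} → TrivialMeet VP LP → contractP {s} VSP ⊆ VP →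
    ∀ (x : Vect s) xP → LP xP → ¬ (xP ≡ zeroV p) → VSP (x ++ xP) → ¬ (x ≡ zeroV s)
  partner-nonzero meet contr x xP xP∈LP xP≢0 xxP∈ x≡0 =
    xP≢0 (meet xP (contr xP (subst (λ z → VSP (z ++ xP)) x≡0 xxP∈)) xP∈LP)

  lifts-exist : ∀ {m} {LP : VSet p} → LP ⊆ restrictP {s} VSP → (B : Fin m → Vect p) → (∀ i → LP (B i)) →
    Σ (Fin m → Vect s) λ xh → ∀ i → VSP (xh i ++ B i)
  lifts-exist LP⊆restr B B∈LP = (λ i → proj₁ (LP⊆restr (B i) (B∈LP i))) , (λ i → proj₂ (LP⊆restr (B i) (B∈LP i)))

  module Lifts {m} (B : Fin m → Vect p) (xh : Fin m → Vect s) (lifts : ∀ i → VSP (xh i ++ B i)) where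

    lift-combination : ∀ (k : Fin m → ℤ) → VSP (lincomb (intCoeffs k) xh ++ lincomb (intCoeffs k) B)
    lift-combination k = pair-lincomb (intCoeffs k) xh B lifts

    span-⊆ : {LP : VSet p} → ZSpan B ⊆ LP → ZSpan xh ⊆ (VSP ↔P LP)
    span-⊆ span⊆LP x (k , x≡) =
      lincomb (intCoeffs k) B , span⊆LP _ (k , refl) , subst (λ z → VSP (z ++ _)) (sym x≡) (lift-combination k)

    ⊆-span : {LP : VSet p} → LP ⊆ ZSpan B → LP ⊆ (VSP ↔S ZSpan xh)
    ⊆-span LP⊆span x x∈LP with LP⊆span x x∈LP
    ... | k , x≡ = lincomb (intCoeffs k) xh , (k , refl) , subst (λ z → VSP (_ ++ z)) (sym x≡) (lift-combination k)

    module _ {VP LP : VSet p} (isVP : IsVectorSpace VP) (meet : TrivialMeet VP LP)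
             (contr : contractP {s} VSP ⊆ VP) (basis : IsBasisMatrix B LP) where

      independent : LinIndep xh
      independent c c·xh≡0 = coefficients-vanish B isVP meet basis c combination∈VP
        where
        combination∈VP : VP (lincomb c B)
        combination∈VP = contr _ (subst (λ z → VSP (z ++ lincomb c B)) c·xh≡0 (pair-lincomb c xh B lifts))

      span-meet : TrivialMeet (VSP ↔P VP) (ZSpan xh)
      span-meet x (hP , hP∈VP , xhP∈) (k , x≡) = begin
        x                                 ≡⟨ x≡ ⟩
        lincomb (intCoeffs k) xh          ≡⟨ lincomb-cong _ _ xh k≡0 ⟩
        lincomb (λ _ → 0ℚ) xh             ≡⟨ lincomb-zero xh ⟩
        zeroV s                           ∎
        where
        open ≡-Reasoning
        w : Vect p
        w = lincomb (intCoeffs k) B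
        xw∈ : VSP (x ++ w)
        xw∈ = subst (λ z → VSP (z ++ w)) (sym x≡) (lift-combination k)
        w∈VP : VP w
        w∈VP = subst VP (-V-+V w hP)
          (IsVectorSpace.add-mem isVP _ _ (partner-difference contr x w hP xw∈ xhP∈) hP∈VP)
        k≡0 : ∀ i → intCoeffs k i ≡ 0ℚ
        k≡0 = coefficients-vanish B isVP meet basis (intCoeffs k) w∈VP

      basis-of : {L : VSet s} → IsNumberLattice L → L ⊆ (VSP ↔P LP) → TrivialMeet L (VSP ↔P VP) →
        (∀ i → L (xh i)) → IsBasisMatrix xh L
      basis-of {L} isNL L⊆ L-meet xh∈L = independent , L⊆span , span⊆L
        where
        span⊆L : ZSpan xh ⊆ L
        span⊆L y (k , y≡) = subst L (sym y≡) (NumberLattice.lincomb-mem isNL xh xh∈L k)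
        L⊆span : L ⊆ ZSpan xh
        L⊆span y y∈L with L⊆ y y∈L
        ... | hP , hP∈LP , yhP∈ with proj₁ (proj₂ basis) hP hP∈LP
        ... | k , hP≡ = k , partner-unique (IsVectorSpace.zero-mem isVP) isNL L-meet y _ hP
                              y∈L (span⊆L _ (k , refl)) yhP∈
                              (subst (λ z → VSP (_ ++ z)) (sym hP≡) (lift-combination k))

theorem4 :
    (s p : ℕ) (VSP : VSet (s + p)) (VP LP : VSet p) →
    IsVectorSpace VSP → IsVectorSpace VP → IsNumberLattice LP →
    TrivialMeet VP LP →
    contractP {s} VSP ⊆ VP →
    (VP ⊕ LP) ⊆ restrictP {s} VSP →
    -- (1)
    (((VSP ↔S (VSP ↔P (VP ⊕ LP))) ≐ (VP ⊕ LP))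
      × ((VSP ↔S (VSP ↔P VP)) ≐ VP))
    -- (2)
    × (∀ (n : ℕ) (B : Fin n → Vect p) → IsBasisMatrix B LP →
        Σ (Fin n → Vect s) (λ xh → ∀ i → VSP (xh i ++ B i))
        × (∀ (xh : Fin n → Vect s) → (∀ i → VSP (xh i ++ B i)) →
            IsBasisMatrix xh (ZSpan xh)
            × (ZSpan xh ⊆ (VSP ↔P LP))
            × (LP ⊆ (VSP ↔S ZSpan xh))
            × TrivialMeet (VSP ↔P VP) (ZSpan xh)
            × ((VSP ↔P (VP ⊕ LP)) ≐ ((VSP ↔P VP) ⊕ ZSpan xh))))
    -- (3)
    × (∀ (L'S : VSet s) → IsNumberLattice L'S →
        L'S ⊆ (VSP ↔P LP) →
        TrivialMeet L'S (VSP ↔P VP) →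
        LP ⊆ (VSP ↔S L'S) →
        -- (a)
        (∀ (xP : Vect p) → LP xP → ¬ (xP ≡ zeroV p) →
          Σ (Vect s) (λ xh → (L'S xh × VSP (xh ++ xP))
            × (∀ y → L'S y → VSP (y ++ xP) → y ≡ xh)
            × ¬ (xh ≡ zeroV s)))
        -- (b)
        × (∀ (n : ℕ) (B : Fin n → Vect p) → IsBasisMatrix B LP →
            ∀ (xh : Fin n → Vect s) → (∀ i → L'S (xh i) × VSP (xh i ++ B i)) →
            IsBasisMatrix xh L'S)
        -- (c)
        × ((VSP ↔P (VP ⊕ LP)) ≐ (L'S ⊕ (VSP ↔P VP))))
theorem4 s p VSP VP LP isVSP isVP isLP meet contr VP+LP⊆restr =
  -- (1) both sets are stable under translation by VP and lie in VSP ∘ P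
  ( recover VP (VP ⊕ LP) contr (⊕-translate VP LP VP.add-mem) VP+LP⊆restr
  , recover VP VP contr VP.add-mem VP⊆restr )
  , (λ n B basis → lifts-exist LP⊆restr B (basis-mem B basis) , λ xh lifts →
      let open Lifts B xh lifts
          span⊆VSP↔LP : ZSpan xh ⊆ (VSP ↔P LP)
          span⊆VSP↔LP = span-⊆ (proj₂ (proj₂ basis))
          LP⊆VSP↔span : LP ⊆ (VSP ↔S ZSpan xh)
          LP⊆VSP↔span = ⊆-span (proj₁ (proj₂ basis))
      in (independent isVP meet contr basis , (λ _ z → z) , (λ _ z → z))
         , span⊆VSP↔LP , LP⊆VSP↔span , span-meet isVP meet contr basis
         , split VP LP (ZSpan xh) span⊆VSP↔LP LP⊆VSP↔span)
  , (λ L isL L⊆ L-meet LP⊆ →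
      (λ xP xP∈LP xP≢0 → let (xh , xh∈L , xhxP∈) = LP⊆ xP xP∈LP in
          xh , (xh∈L , xhxP∈)
        , (λ y y∈L yxP∈ → partner-unique VP.zero-mem isL L-meet y xh xP y∈L xh∈L yxP∈ xhxP∈)
        , partner-nonzero meet contr xh xP xP∈LP xP≢0 xhxP∈)
      , (λ n B basis xh lifts → Lifts.basis-of B xh (λ i → proj₂ (lifts i)) isVP meet contr basis
                                   isL L⊆ L-meet (λ i → proj₁ (lifts i)))
      , (let (into , onto) = split VP LP L L⊆ LP⊆ in
           (λ x x∈ → ⊕-comm _ L x (into x x∈)) , (λ x x∈ → onto x (⊕-comm L _ x x∈))))
  where
  open MatchedComposition {s} {p} VSP isVSP
  module VP = IsVectorSpace isVP
  LP⊆restr : LP ⊆ restrictP {s} VSP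
  LP⊆restr x x∈LP = VP+LP⊆restr x (⊕-inclusionʳ VP LP VP.zero-mem x x∈LP)
  VP⊆restr : VP ⊆ restrictP {s} VSP
  VP⊆restr x x∈VP = VP+LP⊆restr x (⊕-inclusionˡ VP LP (NumberLattice.zero-mem isLP) x x∈VP)
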